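{- Let $n \geq 6$ be an even integer and suppose that $n$ has a prime factor $p$ with $3 < p \leq \lceil \log_2 n \rceil$ such that $2$ is a primitive root modulo $p$. Then $\gamma(KG_n) \leq \frac{n}{p} < \frac{n}{4}$.
   Context: For even $n \geq 6$, the Knödel graph $KG_n$ has vertex set $\{0,1,\dots,n-1\}$, and $\{x,y\}$ is an edge if and only if $x + y \equiv 2^t - 1 \pmod n$ for some $t \in \{1,2,\dots,\lfloor \log_2 n\rfloor\}$. A dominating set of a graph $G$ is a set $D$ of vertices such that every vertex is in $D$ or adjacent to a vertex of $D$; $\gamma(G)$ denotes the minimum size of a dominating set. -}

module Defs where

open import Data.Nat using (ℕ; zero; suc; _+_; _*_; _∸_; _^_; _≤_; _<_; NonZero)
open import Data.Nat.DivMod using (_%_)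
open import Data.Nat.Logarithm using (⌊log₂_⌋)
open import Data.Fin using (Fin; toℕ)
open import Data.Product using (Σ; ∃; _×_)
open import Data.Sum using (_⊎_)
open import Data.List using (List; length)
open import Data.List.Membership.Propositional using (_∈_)
open import Data.List.Relation.Unary.Unique.Propositional using (Unique)
open import Relation.Binary.PropositionalEquality using (_≡_; _≢_)

KGAdj : (n : ℕ) → .{{_ : NonZero n}} → Fin n → Fin n → Set
KGAdj n x y = Σ ℕ λ t → (1 ≤ t) × (t ≤ ⌊log₂ n ⌋) ×
  ((toℕ x + toℕ y) % n ≡ (2 ^ t ∸ 1) % n)

IsDominatingKG : (n : ℕ) → .{{_ : NonZero n}} → List (Fin n) → Set
IsDominatingKG n D = (v : Fin n) → (v ∈ D) ⊎ (Σ (Fin n) λ d → (d ∈ D) × KGAdj n v d)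

DomNumberKG≤ : (n : ℕ) → .{{_ : NonZero n}} → ℕ → Set
DomNumberKG≤ n k = Σ (List (Fin n)) λ D → Unique D × IsDominatingKG n D × length D ≤ k

TwoIsPrimitiveRootMod : (p : ℕ) → .{{_ : NonZero p}} → Set
TwoIsPrimitiveRootMod p = ((2 ^ (p ∸ 1)) % p ≡ 1 % p)
                        × ((k : ℕ) → 1 ≤ k → k < p ∸ 1 → (2 ^ k) % p ≢ 1 % p)

-- Let c = (p - 1) / 2 and D = {v : v ≡ c (mod p)}, a set of n / p vertices.
-- A vertex v ∉ D has v + c + 1 ≢ 0 (mod p), and since 2 generates the
-- multiplicative group mod p, v + c + 1 ≡ 2^t (mod p) for some 1 ≤ t ≤ p - 1.
-- The neighbour d of v with v + d ≡ 2^t - 1 (mod n) then satisfies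
-- d ≡ 2^t - 1 - v ≡ c (mod p), since p ∣ n; and t ≤ p - 1 ≤ ⌊log₂ n⌋.
module Submission where

open import Data.Empty using (⊥-elim)
open import Data.Fin using (Fin; toℕ; fromℕ<; punchOut) renaming (_≟_ to _≟ᶠ_)
open import Data.Fin.Properties
  using (any?; punchOut-injective; <⇒notInjective; toℕ<n; toℕ-fromℕ<; toℕ-injective)
open import Data.List using (List; tabulate; length)
open import Data.List.Membership.Propositional using (_∈_)
open import Data.List.Membership.Propositional.Properties using (∈-tabulate⁺)
open import Data.List.Properties using (length-tabulate)
open import Data.List.Relation.Unary.Unique.Propositional using (Unique)
open import Data.List.Relation.Unary.Unique.Propositional.Properties using (tabulate⁺)
open import Data.Nat
open import Data.Nat.DivMod
open import Data.Nat.Divisibility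
open import Data.Nat.Logarithm
open import Data.Nat.Primality
open import Data.Nat.Properties
open import Data.Product
open import Data.Sum using (_⊎_; inj₁; inj₂; [_,_]′)
open import Function using (_∘_)
open import Function.Definitions using (Injective)
open import Relation.Binary.Definitions using (tri<; tri≈; tri>)
open import Relation.Nullary using (¬_; yes; no; contradiction)
open import Relation.Binary.PropositionalEquality

open import Defs

n<2^[1+⌊log₂n⌋] : ∀ n → n < 2 ^ suc ⌊log₂ n ⌋
n<2^[1+⌊log₂n⌋] n = ≰⇒> λ 2^[1+k]≤n →
  1+n≰n (subst (_≤ ⌊log₂ n ⌋) (⌊log₂[2^n]⌋≡n _) (⌊log₂⌋-mono-≤ 2^[1+k]≤n))

⌈log₂n⌉≤1+⌊log₂n⌋ : ∀ n → ⌈log₂ n ⌉ ≤ suc ⌊log₂ n ⌋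
⌈log₂n⌉≤1+⌊log₂n⌋ n =
  subst (⌈log₂ n ⌉ ≤_) (⌈log₂2^n⌉≡n _) (⌈log₂⌉-mono-≤ (<⇒≤ (n<2^[1+⌊log₂n⌋] n)))

injective⇒surjective : ∀ {m} (f : Fin m → Fin m) → Injective _≡_ _≡_ f →
                       ∀ y → ∃ λ x → f x ≡ y
injective⇒surjective {suc m} f f-inj y with any? (λ x → f x ≟ᶠ y)
... | yes hit = hit
... | no miss = ⊥-elim (<⇒notInjective (n<1+n m) punchOut-f-injective)
  where
  y≢f : ∀ x → y ≢ f x
  y≢f x = miss ∘ (x ,_) ∘ sym

  punchOut-f-injective : Injective _≡_ _≡_ (λ x → punchOut (y≢f x))
  punchOut-f-injective {i} {j} = f-inj ∘ punchOut-injective (y≢f i) (y≢f j)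

odd⊎even : ∀ n → (∃ λ c → c + suc c ≡ n) ⊎ (∃ λ c → c + c ≡ n)
odd⊎even zero = inj₂ (0 , refl)
odd⊎even (suc n) with odd⊎even n
... | inj₁ (c , refl) = inj₂ (suc c , refl)
... | inj₂ (c , refl) = inj₁ (c , +-suc c c)

odd-prime : ∀ {p} → Prime p → 2 < p → ∃ λ c → c + suc c ≡ p
odd-prime {p} pr 2<p with odd⊎even p
... | inj₁ odd = odd
... | inj₂ (c , c+c≡p) = contradiction (composite 2<p 2∣p) (Prime.notComposite pr)
  where
  2∣p : 2 ∣ p
  2∣p = divides c (trans (sym c+c≡p) (trans (cong (c +_) (sym (*-identityʳ c))) (sym (*-suc c 1))))

prime∤^ : ∀ {p a} → Prime p → ¬ p ∣ a → ∀ i → ¬ p ∣ a ^ i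
prime∤^ pr _ zero p∣1 = ¬prime[1] (subst Prime (∣1⇒≡1 p∣1) pr)
prime∤^ {a = a} pr p∤a (suc i) p∣aⁱ⁺¹ =
  [ p∤a , prime∤^ pr p∤a i ]′ (euclidsLemma a (a ^ i) pr p∣aⁱ⁺¹)

+-congʳ-% : ∀ {d x y} .{{_ : NonZero d}} k → x % d ≡ y % d → (x + k) % d ≡ (y + k) % d
+-congʳ-% {d} {x} {y} k eq = begin
  (x + k) % d           ≡⟨ %-distribˡ-+ x k d ⟩
  (x % d + k % d) % d   ≡⟨ cong (λ r → (r + k % d) % d) eq ⟩
  (y % d + k % d) % d   ≡⟨ %-distribˡ-+ y k d ⟨
  (y + k) % d           ∎
  where open ≡-Reasoning

+-cancelʳ-% : ∀ {d} .{{_ : NonZero d}} x y k → (x + k) % d ≡ (y + k) % d → x % d ≡ y % d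
+-cancelʳ-% {d@(suc d-1)} x y k eq = begin
  x % d                       ≡⟨ [m+kn]%n≡m%n x k d ⟨
  (x + k * d) % d             ≡⟨ cong (_% d) (regroup x) ⟩
  (x + k + k * d-1) % d       ≡⟨ +-congʳ-% {x = x + k} {y + k} (k * d-1) eq ⟩
  (y + k + k * d-1) % d       ≡⟨ cong (_% d) (regroup y) ⟨
  (y + k * d) % d             ≡⟨ [m+kn]%n≡m%n y k d ⟩
  y % d                       ∎
  where
  open ≡-Reasoning
  regroup : ∀ z → z + k * suc d-1 ≡ z + k + k * d-1
  regroup z = trans (cong (z +_) (*-suc k d-1)) (sym (+-assoc z k (k * d-1)))

∣⇒%-cong : ∀ {d n x y} .{{_ : NonZero d}} .{{_ : NonZero n}} →
           d ∣ n → x % n ≡ y % n → x % d ≡ y % d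
∣⇒%-cong {d} {n} {x} {y} d∣n eq = begin
  x % d       ≡⟨ m∣n⇒o%n%m≡o%m d n x d∣n ⟨
  x % n % d   ≡⟨ cong (_% d) eq ⟩
  y % n % d   ≡⟨ m∣n⇒o%n%m≡o%m d n y d∣n ⟩
  y % d       ∎
  where open ≡-Reasoning

module _ {p : ℕ} .{{_ : NonZero p}} (pr : Prime p) where

  a*[z+k]%p≡a*z%p⇒p∣k : ∀ {a} → ¬ p ∣ a → ∀ z k → (a * (z + k)) % p ≡ (a * z) % p → p ∣ k
  a*[z+k]%p≡a*z%p⇒p∣k {a} p∤a z k eq with euclidsLemma a k pr p∣ak
    where
    p∣ak : p ∣ a * k
    p∣ak = m%n≡0⇒n∣m (a * k) p (begin
      a * k % p           ≡⟨ +-cancelʳ-% (a * k) 0 (a * z) (begin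
        (a * k + a * z) % p   ≡⟨ cong (_% p) (+-comm (a * k) (a * z)) ⟩
        (a * z + a * k) % p   ≡⟨ cong (_% p) (*-distribˡ-+ a z k) ⟨
        a * (z + k) % p       ≡⟨ eq ⟩
        a * z % p             ∎) ⟩
      0 % p               ≡⟨ m<n⇒m%n≡m (>-nonZero⁻¹ p) ⟩
      0                   ∎)
      where open ≡-Reasoning
  ... | inj₁ p∣a = contradiction p∣a p∤a
  ... | inj₂ p∣k = p∣k

  *-cancelˡ-% : ∀ {a} → ¬ p ∣ a → ∀ x y → (a * x) % p ≡ (a * y) % p → x % p ≡ y % p
  *-cancelˡ-% p∤a x y eq with ≤-total x y
  ... | inj₁ x≤y with k , refl ← m≤n⇒∃[o]m+o≡n x≤y =
    sym (%-remove-+ʳ x (a*[z+k]%p≡a*z%p⇒p∣k p∤a x k (sym eq)))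
  ... | inj₂ y≤x with k , refl ← m≤n⇒∃[o]m+o≡n y≤x =
    %-remove-+ʳ y (a*[z+k]%p≡a*z%p⇒p∣k p∤a y k eq)

module PowersOfPrimitiveRoot {p g : ℕ} .{{_ : NonZero p}} (pr : Prime p) (p∤g : ¬ p ∣ g)
  (order : ∀ k → 1 ≤ k → k < p ∸ 1 → g ^ k % p ≢ 1 % p) where

  ^-%-injective : ∀ {i j} → 1 ≤ i → i < j → j ≤ p ∸ 1 → g ^ i % p ≢ g ^ j % p
  ^-%-injective {i} 1≤i i<j j≤p-1 gⁱ≡gʲ with k , refl ← m≤n⇒∃[o]m+o≡n i<j =
    order (suc k) (s≤s z≤n) (<-≤-trans (s≤s (+-monoˡ-≤ k 1≤i)) j≤p-1)
      (*-cancelˡ-% pr (prime∤^ pr p∤g i) (g ^ suc k) 1 (begin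
        g ^ i * g ^ suc k % p   ≡⟨ cong (_% p) (^-distribˡ-+-* g i (suc k)) ⟨
        g ^ (i + suc k) % p     ≡⟨ cong (λ e → g ^ e % p) (+-suc i k) ⟩
        g ^ suc (i + k) % p     ≡⟨ gⁱ≡gʲ ⟨
        g ^ i % p               ≡⟨ cong (_% p) (*-identityʳ (g ^ i)) ⟨
        g ^ i * 1 % p           ∎))
    where open ≡-Reasoning

  0<g^k%p : ∀ k → 0 < g ^ k % p
  0<g^k%p k = n≢0⇒n>0 (prime∤^ pr p∤g k ∘ m%n≡0⇒n∣m (g ^ k) p)

  -- Fin (p - 1) encodes both the exponents 1, …, p - 1 and the nonzero
  -- residues 1, …, p - 1, each shifted down by one.
  exp : Fin (p ∸ 1) → Fin (p ∸ 1)
  exp t = fromℕ< (∸-monoˡ-< (m%n<n (g ^ suc (toℕ t)) p) (0<g^k%p (suc (toℕ t))))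

  suc-toℕ-exp : ∀ t → suc (toℕ (exp t)) ≡ g ^ suc (toℕ t) % p
  suc-toℕ-exp t = trans (cong suc (toℕ-fromℕ< _)) (m+[n∸m]≡n (0<g^k%p (suc (toℕ t))))

  exp≡⇒^%≡ : ∀ {i j} → exp i ≡ exp j → g ^ suc (toℕ i) % p ≡ g ^ suc (toℕ j) % p
  exp≡⇒^%≡ {i} {j} expᵢ≡expⱼ =
    trans (sym (suc-toℕ-exp i)) (trans (cong (suc ∘ toℕ) expᵢ≡expⱼ) (suc-toℕ-exp j))

  exp-injective : Injective _≡_ _≡_ exp
  exp-injective {i} {j} expᵢ≡expⱼ with <-cmp (toℕ i) (toℕ j)
  ... | tri< i<j _ _ =
    contradiction (exp≡⇒^%≡ {i} {j} expᵢ≡expⱼ) (^-%-injective (s≤s z≤n) (s≤s i<j) (toℕ<n j))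
  ... | tri≈ _ i≡j _ = toℕ-injective i≡j
  ... | tri> _ _ j<i =
    contradiction (exp≡⇒^%≡ {j} {i} (sym expᵢ≡expⱼ)) (^-%-injective (s≤s z≤n) (s≤s j<i) (toℕ<n i))

  nonzero-residue≡^ : ∀ r → 0 < r → r < p → ∃ λ t → 1 ≤ t × t ≤ p ∸ 1 × g ^ t % p ≡ r
  nonzero-residue≡^ (suc r) _ 1+r<p
    with t , expₜ≡r ← injective⇒surjective exp exp-injective (fromℕ< (∸-monoˡ-< 1+r<p (s≤s z≤n))) =
    suc (toℕ t) , s≤s z≤n , toℕ<n t ,
    trans (sym (suc-toℕ-exp t)) (cong suc (trans (cong toℕ expₜ≡r) (toℕ-fromℕ< _)))

module ResidueClass {n d : ℕ} .{{_ : NonZero d}} (d∣n : d ∣ n) {c : ℕ} (c<d : c < d) where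

  member< : (j : Fin (n / d)) → c + toℕ j * d < n
  member< j = begin-strict
    c + toℕ j * d     <⟨ +-monoˡ-< (toℕ j * d) c<d ⟩
    suc (toℕ j) * d   ≤⟨ *-monoˡ-≤ d (toℕ<n j) ⟩
    n / d * d         ≡⟨ m/n*n≡m d∣n ⟩
    n                 ∎
    where open ≤-Reasoning

  member : Fin (n / d) → Fin n
  member j = fromℕ< (member< j)

  member-injective : Injective _≡_ _≡_ member
  member-injective {i} {j} eq = toℕ-injective (*-cancelʳ-≡ (toℕ i) (toℕ j) d
    (+-cancelˡ-≡ c _ _ (trans (sym (toℕ-fromℕ< (member< i))) (trans (cong toℕ eq) (toℕ-fromℕ< (member< j))))))

  residueClass : List (Fin n)
  residueClass = tabulate member

  residueClass-unique : Unique residueClass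
  residueClass-unique = tabulate⁺ member-injective

  length-residueClass : length residueClass ≡ n / d
  length-residueClass = length-tabulate member

  ∈-residueClass : ∀ v → toℕ v % d ≡ c → v ∈ residueClass
  ∈-residueClass v v%d≡c = subst (_∈ residueClass) (sym v≡member) (∈-tabulate⁺ j)
    where
    v/d<n/d : toℕ v / d < n / d
    v/d<n/d = m<n*o⇒m/o<n (subst (toℕ v <_) (sym (m/n*n≡m d∣n)) (toℕ<n v))

    j : Fin (n / d)
    j = fromℕ< v/d<n/d

    v≡member : v ≡ member j
    v≡member = toℕ-injective (begin
      toℕ v                        ≡⟨ m≡m%n+[m/n]*n (toℕ v) d ⟩
      toℕ v % d + toℕ v / d * d    ≡⟨ cong₂ (λ r q → r + q * d) v%d≡c (sym (toℕ-fromℕ< v/d<n/d)) ⟩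
      c + toℕ j * d                ≡⟨ toℕ-fromℕ< (member< j) ⟨
      toℕ (member j)               ∎)
      where open ≡-Reasoning

partner : ∀ {n} .{{_ : NonZero n}} → ℕ → Fin n → Fin n
partner {n} a x = fromℕ< (m%n<n (a + (n ∸ toℕ x)) n)

partner-+ : ∀ {n} .{{_ : NonZero n}} a x → (toℕ (partner a x) + toℕ x) % n ≡ a % n
partner-+ {n} a x = begin
  (toℕ (partner a x) + X) % n   ≡⟨ cong (λ y → (y + X) % n) (toℕ-fromℕ< _) ⟩
  ((a + (n ∸ X)) % n + X) % n   ≡⟨ +-congʳ-% X (m%n%n≡m%n (a + (n ∸ X)) n) ⟩
  (a + (n ∸ X) + X) % n         ≡⟨ cong (_% n) (+-assoc a (n ∸ X) X) ⟩
  (a + (n ∸ X + X)) % n         ≡⟨ cong (λ m → (a + m) % n) (m∸n+n≡m (<⇒≤ (toℕ<n x))) ⟩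
  (a + n) % n                   ≡⟨ [m+n]%n≡m%n a n ⟩
  a % n                         ∎
  where
  open ≡-Reasoning
  X = toℕ x

partner-adjacent : ∀ {n} .{{_ : NonZero n}} {t} → 1 ≤ t → t ≤ ⌊log₂ n ⌋ →
                   ∀ x → KGAdj n x (partner (2 ^ t ∸ 1) x)
partner-adjacent {t = t} 1≤t t≤⌊log₂n⌋ x =
  t , 1≤t , t≤⌊log₂n⌋ , trans (cong (_% _) (+-comm (toℕ x) _)) (partner-+ (2 ^ t ∸ 1) x)

module _ {n p c : ℕ} .{{_ : NonZero n}} .{{_ : NonZero p}} (p∣n : p ∣ n) (c+1+c≡p : c + suc c ≡ p)
  (powers : ∀ r → 0 < r → r < p → ∃ λ t → 1 ≤ t × t ≤ ⌊log₂ n ⌋ × 2 ^ t % p ≡ r) where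

  c<p : c < p
  c<p = subst (c <_) c+1+c≡p (m≤n+m (suc c) c)

  open ResidueClass p∣n c<p

  0<[x+1+c]%p : ∀ x → x % p ≢ c → 0 < (x + suc c) % p
  0<[x+1+c]%p x x%p≢c = n≢0⇒n>0 λ [x+1+c]%p≡0 →
    x%p≢c (trans (+-cancelʳ-% x c (suc c) (begin
      (x + suc c) % p   ≡⟨ [x+1+c]%p≡0 ⟩
      0                 ≡⟨ n%n≡0 p ⟨
      p % p             ≡⟨ cong (_% p) c+1+c≡p ⟨
      (c + suc c) % p   ∎)) (m<n⇒m%n≡m c<p))
    where open ≡-Reasoning

  partner-%-class : ∀ (x : Fin n) t → 2 ^ t % p ≡ (toℕ x + suc c) % p →
                    toℕ (partner (2 ^ t ∸ 1) x) % p ≡ c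
  partner-%-class x t 2ᵗ≡x+1+c = trans (+-cancelʳ-% y c (suc X) (begin
    (y + suc X) % p         ≡⟨ cong (λ z → (y + z) % p) (+-comm 1 X) ⟩
    (y + (X + 1)) % p       ≡⟨ cong (_% p) (+-assoc y X 1) ⟨
    (y + X + 1) % p         ≡⟨ +-congʳ-% 1 (∣⇒%-cong p∣n (partner-+ (2 ^ t ∸ 1) x)) ⟩
    (2 ^ t ∸ 1 + 1) % p     ≡⟨ cong (_% p) (m∸n+n≡m (m^n>0 2 t)) ⟩
    2 ^ t % p               ≡⟨ 2ᵗ≡x+1+c ⟩
    (X + suc c) % p         ≡⟨ cong (_% p) (trans (+-comm X (suc c)) (sym (+-suc c X))) ⟩
    (c + suc X) % p         ∎)) (m<n⇒m%n≡m c<p)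
    where
    open ≡-Reasoning
    X = toℕ x
    y = toℕ (partner (2 ^ t ∸ 1) x)

  residueClass-dominatesKG : IsDominatingKG n residueClass
  residueClass-dominatesKG v with toℕ v % p ≟ c
  ... | yes v%p≡c = inj₁ (∈-residueClass v v%p≡c)
  ... | no v%p≢c
    with t , 1≤t , t≤⌊log₂n⌋ , 2ᵗ≡v+1+c ← powers _ (0<[x+1+c]%p (toℕ v) v%p≢c) (m%n<n _ p) =
    inj₂ (partner (2 ^ t ∸ 1) v , ∈-residueClass _ (partner-%-class v t 2ᵗ≡v+1+c) ,
          partner-adjacent 1≤t t≤⌊log₂n⌋ v)

  domNumberKG≤n/p : DomNumberKG≤ n (n / p)
  domNumberKG≤n/p =
    residueClass , residueClass-unique , residueClass-dominatesKG , ≤-reflexive length-residueClass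

corollary7 : (n : ℕ) → .{{_ : NonZero n}} → 6 ≤ n → 2 ∣ n →
    (p : ℕ) → .{{_ : NonZero p}} → Prime p → p ∣ n → 3 < p → p ≤ ⌈log₂ n ⌉ →
    TwoIsPrimitiveRootMod p →
    DomNumberKG≤ n (n / p) × (4 * n < p * n)
corollary7 n _ _ p pr p∣n 3<p p≤⌈log₂n⌉ (_ , order)
  with c , c+1+c≡p ← odd-prime pr (<-trans (n<1+n 2) 3<p) =
  domNumberKG≤n/p p∣n c+1+c≡p powers , *-monoˡ-< n 4<p
  where
  p∤2 : ¬ p ∣ 2
  p∤2 p∣2 = <⇒≱ (<-trans (n<1+n 2) 3<p) (∣⇒≤ p∣2)

  p-1≤⌊log₂n⌋ : p ∸ 1 ≤ ⌊log₂ n ⌋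
  p-1≤⌊log₂n⌋ = ∸-monoˡ-≤ 1 (≤-trans p≤⌈log₂n⌉ (⌈log₂n⌉≤1+⌊log₂n⌋ n))

  powers : ∀ r → 0 < r → r < p → ∃ λ t → 1 ≤ t × t ≤ ⌊log₂ n ⌋ × 2 ^ t % p ≡ r
  powers r 0<r r<p with t , 1≤t , t≤p-1 , 2ᵗ≡r ←
    PowersOfPrimitiveRoot.nonzero-residue≡^ pr p∤2 order r 0<r r<p =
    t , 1≤t , ≤-trans t≤p-1 p-1≤⌊log₂n⌋ , 2ᵗ≡r

  4<p : 4 < p
  4<p = ≤∧≢⇒< 3<p (λ 4≡p → composite⇒¬prime composite[4] (subst Prime (sym 4≡p) pr))
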